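{- Let $F\colon\mathbf{Sets}\to\mathbf{Sets}$ be a functor which preserves weak pullbacks, $\lambda$ and $\overline{F}$ as described below, and $\alpha\colon FA\xrightarrow{\cong}A$ an initial $F$-algebra in $\mathbf{Sets}$ (so $J(\alpha^{ -1})\colon A\to\overline{F}A$ is a final $\overline{F}$-coalgebra in $\mathcal{K}\ell(\mathcal{P})$). Let $c\colon X\to\overline{F}X$ be a coalgebra in $\mathcal{K}\ell(\mathcal{P})$, i.e. a function $c\colon X\to\mathcal{P}FX$. Let $\mathsf{tr}_c\colon X\to A$ be the unique arrow in $\mathcal{K}\ell(\mathcal{P})$ with $\overline{F}(\mathsf{tr}_c)\circ c=J(\alpha^{ -1})\circ\mathsf{tr}_c$. Let $[\![\cdot]\!]_c\colon A\to\mathcal{P}X$ be the unique function with $[\![\cdot]\!]_c\circ\alpha=K\mathit{Op}(c)\circ\lambda_X\circ F[\![\cdot]\!]_c$, and let $\mathsf{th}_c\colon X\to A$ be the arrow of $\mathcal{K}\ell(\mathcal{P})$ given by $\mathsf{th}_c(x)=\{a\in A\mid x\in[\![a]\!]_c\}$. Then $\mathsf{tr}_c=\mathsf{th}_c$.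
   Context: $\mathcal{P}$: powerset monad (unit $\eta$ singletons, multiplication $\mu$ union). $\mathcal{K}\ell(\mathcal{P})$: objects sets, arrows $X\to Y$ functions $X\to\mathcal{P}Y$, composition $g\circ f=\mu\circ\mathcal{P}g\circ f$; $J\colon\mathbf{Sets}\to\mathcal{K}\ell(\mathcal{P})$, $Jf=\eta\circ f$; $K\colon\mathcal{K}\ell(\mathcal{P})\to\mathbf{Sets}$, $KX=\mathcal{P}X$, $Kf=\mu\circ\mathcal{P}f$. $\mathit{Op}$ sends $f\colon X\to\mathcal{P}Y$ to $f^\vee\colon Y\to\mathcal{P}X$, $f^\vee(y)=\{x\mid y\in f(x)\}$; so $K\mathit{Op}(c)\colon\mathcal{P}FX\to\mathcal{P}X$ maps $S$ to $\{x\mid c(x)\cap S\neq\emptyset\}$. For $R\subseteq X\times Y$, $\mathrm{Rel}_F(R)$ is the image of $\langle Fr_1,Fr_2\rangle\colon FR\to FX\times FY$. $\lambda_X\colon F\mathcal{P}X\to\mathcal{P}FX$ is $\lambda_X(u)=\{v\in FX\mid(v,u)\in\mathrm{Rel}_F(\in_X)\}$, and $\overline{F}X=FX$, $\overline{F}f=\lambda_Y\circ Ff$ for $f\colon X\to\mathcal{P}Y$. (In the paper's terms, $\mathsf{th}_c$ is the theory map of the testing situation with $\mathbb{C}=\mathcal{K}\ell(\mathcal{P})$, $\mathbb{A}=\mathbf{Sets}$, $P=K\circ\mathit{Op}$, $M=F$, denotation $\lambda$, and tests given by the initial $F$-algebra.) -}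

module Defs where

open import Level using (Level; _⊔_; suc; Setω)
open import Data.Product using (Σ; Σ-syntax; ∃; ∃-syntax; _×_; _,_; proj₁; proj₂)
open import Relation.Binary.PropositionalEquality using (_≡_)
open import Function using (_∘_; id)
open import Function.Bundles using (_⇔_)

record SetFunctor : Setω where
  field
    F      : ∀ {ℓ} → Set ℓ → Set ℓ
    fmap   : ∀ {a b} {A : Set a} {B : Set b} → (A → B) → F A → F B
    fmap-id : ∀ {a} {A : Set a} (u : F A) → fmap id u ≡ u
    fmap-∘ : ∀ {a b c} {A : Set a} {B : Set b} {C : Set c}
             (g : B → C) (f : A → B) (u : F A) → fmap (g ∘ f) u ≡ fmap g (fmap f u)
    fmap-cong : ∀ {a b} {A : Set a} {B : Set b} {f g : A → B} →
                (∀ x → f x ≡ g x) → ∀ u → fmap f u ≡ fmap g u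

IsWeakPullback : ∀ {a b c p} {A : Set a} {B : Set b} {C : Set c} {P : Set p} →
                 (A → C) → (B → C) → (P → A) → (P → B) → Set (a ⊔ b ⊔ c ⊔ p)
IsWeakPullback {P = P} f g p₁ p₂ =
  (∀ (q : P) → f (p₁ q) ≡ g (p₂ q)) ×
  (∀ x y → f x ≡ g y → Σ[ q ∈ P ] (p₁ q ≡ x × p₂ q ≡ y))

PreservesWeakPullbacks : SetFunctor → Setω
PreservesWeakPullbacks Φ =
  ∀ {a b c p} {A : Set a} {B : Set b} {C : Set c} {P : Set p}
    (f : A → C) (g : B → C) (p₁ : P → A) (p₂ : P → B) →
    IsWeakPullback f g p₁ p₂ → IsWeakPullback (fmap f) (fmap g) (fmap p₁) (fmap p₂)
  where open SetFunctor Φ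

IsInitialAlgebra : (Φ : SetFunctor) → ∀ {a} {A : Set a} → (SetFunctor.F Φ A → A) → Setω
IsInitialAlgebra Φ {A = A} α =
  ∀ {b} {B : Set b} (β : F B → B) →
    Σ[ h ∈ (A → B) ] ((∀ u → h (α u) ≡ β (fmap h u)) ×
      (∀ (h' : A → B) → (∀ u → h' (α u) ≡ β (fmap h' u)) → ∀ x → h' x ≡ h x))
  where open SetFunctor Φ

𝒫 : ∀ {a} (ℓ : Level) → Set a → Set (a ⊔ suc ℓ)
𝒫 ℓ X = X → Set ℓ

Kl : ∀ {a b} (ℓ : Level) → Set a → Set b → Set (a ⊔ b ⊔ suc ℓ)
Kl ℓ X Y = X → 𝒫 ℓ Y

_≐_ : ∀ {a ℓ ℓ'} {X : Set a} → 𝒫 ℓ X → 𝒫 ℓ' X → Set (a ⊔ ℓ ⊔ ℓ')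
S ≐ T = ∀ x → S x ⇔ T x

_≐Kl_ : ∀ {a b ℓ ℓ'} {X : Set a} {Y : Set b} → Kl ℓ X Y → Kl ℓ' X Y → Set (a ⊔ b ⊔ ℓ ⊔ ℓ')
f ≐Kl g = ∀ x → f x ≐ g x

-- Kleisli composition  g ∘ f = μ ∘ 𝒫 g ∘ f
_⊙_ : ∀ {a b c ℓ ℓ'} {X : Set a} {Y : Set b} {Z : Set c} →
      Kl ℓ' Y Z → Kl ℓ X Y → Kl (b ⊔ ℓ ⊔ ℓ') X Z
(g ⊙ f) x z = ∃[ y ] (f x y × g y z)

-- J f = η ∘ f  (singletons)
J : ∀ {a b} {X : Set a} {Y : Set b} → (X → Y) → Kl b X Y
J f x y = f x ≡ y

-- K f = μ ∘ 𝒫 f : 𝒫 X → 𝒫 Y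
K : ∀ {a b ℓ ℓ'} {X : Set a} {Y : Set b} → Kl ℓ X Y → 𝒫 ℓ' X → 𝒫 (a ⊔ ℓ ⊔ ℓ') Y
K f S y = ∃[ x ] (S x × f x y)

Op : ∀ {a b ℓ} {X : Set a} {Y : Set b} → Kl ℓ X Y → Kl ℓ Y X
Op f y x = f x y

module _ (Φ : SetFunctor) where
  open SetFunctor Φ

  -- Rel_F(R): image of ⟨F r₁, F r₂⟩ : F R → F X × F Y
  RelF : ∀ {a b r} {X : Set a} {Y : Set b} → (X → Y → Set r) →
         F X → F Y → Set (a ⊔ b ⊔ r)
  RelF {X = X} {Y = Y} R u v =
    Σ[ w ∈ F (Σ[ p ∈ X × Y ] R (proj₁ p) (proj₂ p)) ]
      (fmap (proj₁ ∘ proj₁) w ≡ u × fmap (proj₂ ∘ proj₁) w ≡ v)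

  Mem : ∀ {a} (ℓ : Level) (X : Set a) → X → 𝒫 ℓ X → Set ℓ
  Mem ℓ X x S = S x

  lam : ∀ {a ℓ} {X : Set a} → F (𝒫 ℓ X) → 𝒫 (a ⊔ suc ℓ) (F X)
  lam {ℓ = ℓ} {X = X} u v = RelF (Mem ℓ X) v u

  Fbar : ∀ {a b ℓ} {X : Set a} {Y : Set b} → Kl ℓ X Y → Kl (b ⊔ suc ℓ) (F X) (F Y)
  Fbar f u = lam (fmap f u)

  TraceEq : ∀ {a x ℓc ℓ} {A : Set a} {X : Set x} →
            (A → F A) → Kl ℓc X (F X) → Kl ℓ X A → Set _
  TraceEq α⁻¹ c t = (Fbar t ⊙ c) ≐Kl (J α⁻¹ ⊙ t)

  SemEq : ∀ {a x ℓc ℓ} {A : Set a} {X : Set x} →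
          (F A → A) → Kl ℓc X (F X) → (A → 𝒫 ℓ X) → Set _
  SemEq α c sem = ∀ u → sem (α u) ≐ K (Op c) (lam (fmap sem u))

th : ∀ {a x ℓ} {A : Set a} {X : Set x} → (A → 𝒫 ℓ X) → Kl ℓ X A
th sem x a = sem a x

module Submission where

-- Write tᵀ a x = t x a for the transpose of a Kleisli arrow t : X → 𝒫 A.
-- The theorem follows from one fact: if t satisfies the trace equation
--   F̄(t) ∘ c = J(α⁻¹) ∘ t,
-- then tᵀ satisfies the semantics equation  tᵀ ∘ α = K Op(c) ∘ λ_X ∘ F tᵀ.
-- Uniqueness of ⟦·⟧_c then gives trᵀ = ⟦·⟧_c, i.e. tr = th_c.
--
-- To compare the two equations we need two facts on relation liftings:
--   * λ_Y ∘ F R = Rel_F(R)  for any relation R ⊆ X × Y seen as R : X → 𝒫 Y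
--     (this is where preservation of weak pullbacks is used), and
--   * Rel_F(R^∨) = Rel_F(R)^∨.
-- Both are instances of a single observation: Rel_F(R) is the image of a
-- span under F, and a morphism of spans transports such images.

open import Defs
open import Level using (Level; _⊔_) renaming (suc to lsuc)
open import Relation.Binary.PropositionalEquality
  using (_≡_; refl; sym; trans; cong; subst; module ≡-Reasoning)
open import Data.Product using (Σ-syntax; _×_; _,_; proj₁; proj₂)
open import Function using (_∘_; flip)
open import Function.Bundles using (_⇔_; mk⇔)
open import Function.Construct.Identity using (↠-id; ⇔-id)
open import Function.Construct.Symmetry using (⇔-sym)
open import Function.Related.Propositional using (module EquationalReasoning)
open import Function.Related.TypeIsomorphisms using (×-comm)
open import Data.Product.Function.Dependent.Propositional using (Σ-⇔)
open import Data.Product.Function.NonDependent.Propositional using (_×-⇔_)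

module _ {a b c} {A : Set a} {B : Set b} {C : Set c} (f : A → C) (g : B → C) where

  Pullback : Set (a ⊔ b ⊔ c)
  Pullback = Σ[ a ∈ A ] Σ[ b ∈ B ] (f a ≡ g b)

  pullback₁ : Pullback → A
  pullback₁ = proj₁

  pullback₂ : Pullback → B
  pullback₂ = proj₁ ∘ proj₂

  pullback-isWeakPullback : IsWeakPullback f g pullback₁ pullback₂
  pullback-isWeakPullback = (λ q → proj₂ (proj₂ q)) , λ a b eq → (a , b , eq) , refl , refl

module RelationLifting (Φ : SetFunctor) where
  open SetFunctor Φ

  fmap-fuse : ∀ {a b c} {A : Set a} {B : Set b} {C : Set c}
    (g : B → C) (f : A → B) (h : A → C) →
    (∀ t → g (f t) ≡ h t) → ∀ u → fmap g (fmap f u) ≡ fmap h u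
  fmap-fuse g f h gf≗h u = trans (sym (fmap-∘ g f u)) (fmap-cong gf≗h u)

  -- The image of a span  X ← G → Y  under F, as a relation on F X × F Y.
  -- Rel_F(R) is (definitionally) the image of the graph span of R.
  SpanImage : ∀ {g x y} {G : Set g} {X : Set x} {Y : Set y} →
              (G → X) → (G → Y) → F X → F Y → Set (g ⊔ x ⊔ y)
  SpanImage {G = G} l r u v = Σ[ w ∈ F G ] (fmap l w ≡ u × fmap r w ≡ v)

  spanImage-converse : ∀ {g x y} {G : Set g} {X : Set x} {Y : Set y}
    {l : G → X} {r : G → Y} {u v} → SpanImage l r u v → SpanImage r l v u
  spanImage-converse (w , lw , rw) = w , rw , lw

  spanImage-reindex : ∀ {g h x y} {G : Set g} {H : Set h} {X : Set x} {Y : Set y}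
    {l : G → X} {r : G → Y} {l' : H → X} {r' : H → Y} (k : G → H) →
    (∀ z → l' (k z) ≡ l z) → (∀ z → r' (k z) ≡ r z) →
    ∀ {u v} → SpanImage l r u v → SpanImage l' r' u v
  spanImage-reindex k l'k≗l r'k≗r (w , lw , rw) =
    fmap k w , trans (fmap-fuse _ k _ l'k≗l w) lw , trans (fmap-fuse _ k _ r'k≗r w) rw

  spanImage-postcompose : ∀ {g x x' y} {G : Set g} {X : Set x} {X' : Set x'} {Y : Set y}
    {l : G → X} {r : G → Y} (f : X → X') →
    ∀ {u v} → SpanImage l r u v → SpanImage (f ∘ l) r (fmap f u) v
  spanImage-postcompose {l = l} f (w , lw , rw) = w , trans (fmap-∘ f l w) (cong (fmap f) lw) , rw

  module _ {x y ℓ} {X : Set x} {Y : Set y} (R : X → Y → Set ℓ) where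

    Graph : Set (x ⊔ y ⊔ ℓ)
    Graph = Σ[ p ∈ X × Y ] R (proj₁ p) (proj₂ p)

    RelF-converse : ∀ u v → RelF Φ (flip R) u v ⇔ RelF Φ R v u
    RelF-converse u v = mk⇔
      (spanImage-converse ∘ spanImage-reindex swapGraph (λ _ → refl) (λ _ → refl))
      (spanImage-reindex unswapGraph (λ _ → refl) (λ _ → refl) ∘ spanImage-converse)
      where
      swapGraph : Σ[ p ∈ Y × X ] R (proj₂ p) (proj₁ p) → Graph
      swapGraph ((y , x) , r) = (x , y) , r
      unswapGraph : Graph → Σ[ p ∈ Y × X ] R (proj₂ p) (proj₁ p)
      unswapGraph ((x , y) , r) = (y , x) , r

    MemGraph : Set (y ⊔ lsuc ℓ)
    MemGraph = Σ[ p ∈ Y × 𝒫 ℓ Y ] Mem Φ ℓ Y (proj₁ p) (proj₂ p)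

    graph→memGraph : Graph → MemGraph
    graph→memGraph ((x , y) , r) = (y , R x) , r

    RelF⇒lam : ∀ v u → RelF Φ R v u → lam Φ (fmap R v) u
    RelF⇒lam v u =
      spanImage-reindex graph→memGraph (λ _ → refl) (λ _ → refl)
      ∘ spanImage-converse ∘ spanImage-postcompose R

    -- λ_Y ∘ F R ⊆ Rel_F(R), using that F preserves the weak pullback of
    -- ∈_Y's second projection along R : X → 𝒫 Y.
    lam⇒RelF : PreservesWeakPullbacks Φ → ∀ v u → lam Φ (fmap R v) u → RelF Φ R v u
    lam⇒RelF pwp v u (w , wY≡u , wS≡Rv) =
      spanImage-reindex pullback→graph (λ _ → refl) (λ _ → refl) (q , qX≡v , qY≡u)
      where
      memSet : MemGraph → 𝒫 ℓ Y
      memSet = proj₂ ∘ proj₁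
      P : Set (x ⊔ y ⊔ lsuc ℓ)
      P = Pullback memSet R
      square : IsWeakPullback (fmap memSet) (fmap R)
                 (fmap (pullback₁ memSet R)) (fmap (pullback₂ memSet R))
      square = pwp _ _ _ _ (pullback-isWeakPullback memSet R)
      lifted : Σ[ q ∈ F P ] (fmap proj₁ q ≡ w × fmap (proj₁ ∘ proj₂) q ≡ v)
      lifted = proj₂ square w v wS≡Rv
      q : F P
      q = proj₁ lifted
      qX≡v : fmap (proj₁ ∘ proj₂) q ≡ v
      qX≡v = proj₂ (proj₂ lifted)
      qY≡u : fmap (proj₁ ∘ proj₁ ∘ proj₁) q ≡ u
      qY≡u = begin
        fmap (proj₁ ∘ proj₁ ∘ proj₁) q      ≡⟨ fmap-∘ (proj₁ ∘ proj₁) proj₁ q ⟩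
        fmap (proj₁ ∘ proj₁) (fmap proj₁ q) ≡⟨ cong (fmap (proj₁ ∘ proj₁)) (proj₁ (proj₂ lifted)) ⟩
        fmap (proj₁ ∘ proj₁) w              ≡⟨ wY≡u ⟩
        u                                   ∎
        where open ≡-Reasoning
      pullback→graph : P → Graph
      pullback→graph (((y , S) , y∈S) , x , S≡Rx) = (x , y) , subst (λ T → T y) S≡Rx y∈S

    lam≐RelF : PreservesWeakPullbacks Φ → ∀ v u → lam Φ (fmap R v) u ⇔ RelF Φ R v u
    lam≐RelF pwp v u = mk⇔ (lam⇒RelF pwp v u) (RelF⇒lam v u)

module TraceIsTheory
  (Φ : SetFunctor) (pwp : PreservesWeakPullbacks Φ)
  {a} {A : Set a} (α : SetFunctor.F Φ A → A) (α⁻¹ : A → SetFunctor.F Φ A)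
  (α⁻¹∘α≗id : ∀ u → α⁻¹ (α u) ≡ u) (α∘α⁻¹≗id : ∀ y → α (α⁻¹ y) ≡ y)
  {x ℓc} {X : Set x} (c : Kl ℓc X (SetFunctor.F Φ X)) where
  open SetFunctor Φ
  open RelationLifting Φ

  J-inverse : ∀ {ℓ} (t : Kl ℓ X A) x u → (J α⁻¹ ⊙ t) x u ⇔ t x (α u)
  J-inverse t x u = mk⇔
    (λ { (b , tb , α⁻¹b≡u) → subst (t x) (trans (sym (α∘α⁻¹≗id b)) (cong α α⁻¹b≡u)) tb })
    (λ t-αu → α u , t-αu , α⁻¹∘α≗id u)

  transpose-solves-SemEq : ∀ {ℓ} (t : Kl ℓ X A) → TraceEq Φ α⁻¹ c t → SemEq Φ α c (flip t)
  transpose-solves-SemEq t trace u x = begin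
    t x (α u)                                      ∼⟨ ⇔-sym (J-inverse t x u) ⟩
    (J α⁻¹ ⊙ t) x u                                ∼⟨ ⇔-sym (trace x u) ⟩
    (Fbar Φ t ⊙ c) x u                             ∼⟨ Σ-⇔ (↠-id _) step ⟩
    K (Op c) (lam Φ (fmap (flip t) u)) x           ∎
    where
    open EquationalReasoning
    step : ∀ {v} → (c x v × lam Φ (fmap t v) u) ⇔ (lam Φ (fmap (flip t) u) v × c x v)
    step {v} = begin
      (c x v × lam Φ (fmap t v) u)                 ∼⟨ ⇔-id _ ×-⇔ lam≐RelF t pwp v u ⟩
      (c x v × RelF Φ t v u)                       ↔⟨ ×-comm _ _ ⟩
      (RelF Φ t v u × c x v)                       ∼⟨ ⇔-sym (RelF-converse t u v) ×-⇔ ⇔-id _ ⟩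
      (RelF Φ (flip t) u v × c x v)                ∼⟨ ⇔-sym (lam≐RelF (flip t) pwp u v) ×-⇔ ⇔-id _ ⟩
      (lam Φ (fmap (flip t) u) v × c x v)          ∎

proposition5p9 : (Φ : SetFunctor) → PreservesWeakPullbacks Φ →
    ∀ {a} {A : Set a} (α : SetFunctor.F Φ A → A) (α⁻¹ : A → SetFunctor.F Φ A) →
    (∀ u → α⁻¹ (α u) ≡ u) → (∀ y → α (α⁻¹ y) ≡ y) →
    IsInitialAlgebra Φ α →
    ∀ {x ℓc ℓ : Level} {X : Set x} (c : Kl ℓc X (SetFunctor.F Φ X)) →
    (tr : Kl ℓ X A) →
    TraceEq Φ α⁻¹ c tr →
    (∀ (t : Kl ℓ X A) → TraceEq Φ α⁻¹ c t → t ≐Kl tr) →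
    (sem : A → 𝒫 ℓ X) →
    SemEq Φ α c sem →
    (∀ (s : A → 𝒫 ℓ X) → SemEq Φ α c s → ∀ y → s y ≐ sem y) →
    tr ≐Kl th sem
proposition5p9 Φ pwp α α⁻¹ α⁻¹∘α≗id α∘α⁻¹≗id _ c tr trace _ sem _ sem-unique x a =
  sem-unique (flip tr) trTransposeSolves a x
  where
  open TraceIsTheory Φ pwp α α⁻¹ α⁻¹∘α≗id α∘α⁻¹≗id c
  trTransposeSolves : SemEq Φ α c (flip tr)
  trTransposeSolves = transpose-solves-SemEq tr trace
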